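{- Let $q=2mn+1$ be a prime power and let $A=(a_{i,j})$ be a rank-one Heffter array H$(m,n)$ over $\mathbb{F}_q$ such that the partial sums $\sum_{k=1}^j a_{1,k}$, $1\le j\le n$, of its first row are pairwise distinct and the partial sums $\sum_{k=1}^i a_{k,1}$, $1\le i\le m$, of its first column are pairwise distinct. Then $A$ is globally simple.
   Context: A half-set of an additive group $G$ of odd order $2\ell+1$ is an $\ell$-subset $L$ with $L\cup -L=G\setminus\{0\}$. A Heffter array H$(m,n)$ over $\mathbb{F}_q$ is an $m\times n$ matrix over $\mathbb{F}_q$ whose entries form a half-set of the additive group of $\mathbb{F}_q$ and whose every row and column sums to $0$; it is rank-one if it has rank $1$ over $\mathbb{F}_q$. An H$(m,n)$ $A=(a_{i,j})$ is globally simple if for each row $i$ the partial sums $\sum_{k=1}^j a_{i,k}$ ($1\le j\le n$) are pairwise distinct and for each column $j$ the partial sums $\sum_{k=1}^i a_{k,j}$ ($1\le i\le m$) are pairwise distinct. -}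

module Defs where

open import Level using (Level; _⊔_)
open import Data.Nat using (ℕ; suc) renaming (_*_ to _*ℕ_)
open import Data.Fin using (Fin; zero; suc; remQuot)
open import Data.Product using (Σ; ∃; _×_; _,_)
open import Data.Sum using (_⊎_)
open import Relation.Nullary using (¬_)
open import Relation.Binary.PropositionalEquality using (_≡_)
open import Algebra.Bundles using (CommutativeRing)

module _ {c ℓ : Level} (R : CommutativeRing c ℓ) where
  open CommutativeRing R hiding (zero)

  IsField : Set (c ⊔ ℓ)
  IsField = (¬ (0# ≈ 1#)) × (∀ x → ¬ (x ≈ 0#) → ∃ λ y → x * y ≈ 1#)

  HasSize : ℕ → Set (c ⊔ ℓ)
  HasSize q = Σ (Fin q → Carrier) λ e →
                (∀ i j → e i ≈ e j → i ≡ j) × (∀ x → ∃ λ i → x ≈ e i)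

  -- A finite field with q elements (q is then automatically a prime power).
  IsFiniteField : ℕ → Set (c ⊔ ℓ)
  IsFiniteField q = IsField × HasSize q

  -- A family of ℓ' elements forms a half-set of the additive group
  -- (whose order is 2ℓ'+1): the elements are pairwise distinct (so they form
  -- an ℓ'-subset L) and L ∪ -L = G ∖ {0}.
  IsHalfSet : {k : ℕ} → (Fin k → Carrier) → Set (c ⊔ ℓ)
  IsHalfSet {k} f =
    (∀ i j → f i ≈ f j → i ≡ j) ×
    (∀ x → (¬ (x ≈ 0#) → ∃ λ i → (x ≈ f i) ⊎ (x ≈ - (f i))) ×
           ((∃ λ i → (x ≈ f i) ⊎ (x ≈ - (f i))) → ¬ (x ≈ 0#)))

  Matrix : ℕ → ℕ → Set c
  Matrix m n = Fin m → Fin n → Carrier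

  sumV : {n : ℕ} → (Fin n → Carrier) → Carrier
  sumV {ℕ.zero} f = 0#
  sumV {suc n} f = f zero + sumV (λ k → f (suc k))

  partialSum : {n : ℕ} → (Fin n → Carrier) → Fin n → Carrier
  partialSum f zero = f zero
  partialSum f (suc j) = f zero + partialSum (λ k → f (suc k)) j

  entries : {m n : ℕ} → Matrix m n → Fin (m *ℕ n) → Carrier
  entries {m} {n} A k with remQuot {m} n k
  ... | (i , j) = A i j

  IsHeffter : (m n : ℕ) → Matrix m n → Set (c ⊔ ℓ)
  IsHeffter m n A =
    IsHalfSet (entries A) ×
    (∀ i → sumV (λ j → A i j) ≈ 0#) ×
    (∀ j → sumV (λ i → A i j) ≈ 0#)

  IsRankOne : {m n : ℕ} → Matrix m n → Set (c ⊔ ℓ)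
  IsRankOne {m} {n} A =
    Σ (Fin m → Carrier) λ u → Σ (Fin n → Carrier) λ v →
      (∃ λ i → ¬ (u i ≈ 0#)) × (∃ λ j → ¬ (v j ≈ 0#)) ×
      (∀ i j → A i j ≈ u i * v j)

  DistinctPartialSums : {n : ℕ} → (Fin n → Carrier) → Set ℓ
  DistinctPartialSums f = ∀ j j' → partialSum f j ≈ partialSum f j' → j ≡ j'

  IsGloballySimple : {m n : ℕ} → Matrix m n → Set ℓ
  IsGloballySimple A =
    (∀ i → DistinctPartialSums (λ j → A i j)) ×
    (∀ j → DistinctPartialSums (λ i → A i j))

{-# OPTIONS --safe #-}
-- A rank-one array is A i j = u i · v j, so row i is the vector v scaled by
-- u i and column j is u scaled by v j.  Every entry of a half-set is nonzero,
-- hence so are all u i and v j; in a field, scaling by a nonzero constant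
-- neither creates nor destroys coincidences among partial sums.  Thus every
-- row inherits distinct partial sums from the first row, and every column
-- from the first column.
module Submission where

open import Defs
open import Level using (Level)
open import Data.Nat using (ℕ; suc; _*_)
open import Data.Fin using (Fin; toℕ; zero; suc; combine)
open import Data.Fin.Properties using (remQuot-combine)
open import Data.Product using (_,_; proj₂; uncurry)
open import Data.Sum using (inj₁)
open import Relation.Binary.PropositionalEquality using (_≡_)
import Relation.Binary.PropositionalEquality as ≡
open import Algebra.Bundles using (CommutativeRing)
import Relation.Binary.Reasoning.Setoid as SetoidReasoning

module _ {c ℓ : Level} (R : CommutativeRing c ℓ) where
  open CommutativeRing R hiding (zero) renaming (_*_ to _·_)
  open SetoidReasoning setoid

  *-cancelˡ-nonzero : IsField R → ∀ {x a b} → x ≉ 0# → x · a ≈ x · b → a ≈ b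
  *-cancelˡ-nonzero (_ , inverse) {x} {a} {b} x≉0 xa≈xb with inverse x x≉0
  ... | y , xy≈1 = begin
    a             ≈⟨ *-identityˡ a ⟨
    1# · a        ≈⟨ *-congʳ (trans (sym xy≈1) (*-comm x y)) ⟩
    (y · x) · a   ≈⟨ *-assoc y x a ⟩
    y · (x · a)   ≈⟨ *-congˡ xa≈xb ⟩
    y · (x · b)   ≈⟨ *-assoc y x b ⟨
    (y · x) · b   ≈⟨ *-congʳ (trans (*-comm y x) xy≈1) ⟩
    1# · b        ≈⟨ *-identityˡ b ⟩
    b             ∎

  partialSum-cong : ∀ {n} {f g : Fin n → Carrier} → (∀ k → f k ≈ g k) →
                    ∀ j → partialSum R f j ≈ partialSum R g j
  partialSum-cong f≈g zero    = f≈g zero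
  partialSum-cong f≈g (suc j) = +-cong (f≈g zero) (partialSum-cong (λ k → f≈g (suc k)) j)

  partialSum-*ˡ : ∀ {n} x (f : Fin n → Carrier) →
                  ∀ j → partialSum R (λ k → x · f k) j ≈ x · partialSum R f j
  partialSum-*ˡ x f zero    = refl
  partialSum-*ˡ x f (suc j) = begin
    x · f zero + partialSum R (λ k → x · f (suc k)) j  ≈⟨ +-congˡ (partialSum-*ˡ x (λ k → f (suc k)) j) ⟩
    x · f zero + x · partialSum R (λ k → f (suc k)) j  ≈⟨ distribˡ x _ _ ⟨
    x · (f zero + partialSum R (λ k → f (suc k)) j)    ∎

  partialSum-scaled : ∀ {n} {x} {f g : Fin n → Carrier} → (∀ k → f k ≈ x · g k) →
                      ∀ j → partialSum R f j ≈ x · partialSum R g j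
  partialSum-scaled {x = x} {g = g} f≈xg j =
    trans (partialSum-cong f≈xg j) (partialSum-*ˡ x g j)

  distinctPartialSums-proportional :
    IsField R → ∀ {n} {x y} {f g h : Fin n → Carrier} → y ≉ 0# →
    (∀ k → f k ≈ x · g k) → (∀ k → h k ≈ y · g k) →
    DistinctPartialSums R f → DistinctPartialSums R h
  distinctPartialSums-proportional isField {x = x} {f = f} {g = g} y≉0 f≈xg h≈yg distinct j j′ hⱼ≈hⱼ′ =
    distinct j j′ (begin
      partialSum R f j       ≈⟨ partialSum-scaled f≈xg j ⟩
      x · partialSum R g j   ≈⟨ *-congˡ gⱼ≈gⱼ′ ⟩
      x · partialSum R g j′  ≈⟨ partialSum-scaled f≈xg j′ ⟨
      partialSum R f j′      ∎)
    where
    gⱼ≈gⱼ′ = *-cancelˡ-nonzero isField y≉0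
      (trans (sym (partialSum-scaled h≈yg j)) (trans hⱼ≈hⱼ′ (partialSum-scaled h≈yg j′)))

  halfSet-nonzero : ∀ {k} {f : Fin k → Carrier} → IsHalfSet R f → ∀ i → f i ≉ 0#
  halfSet-nonzero (_ , covers) i = proj₂ (covers _) (i , inj₁ refl)

  entries-combine : ∀ {m n} (A : Matrix R m n) i j → entries R A (combine i j) ≡ A i j
  entries-combine {n = n} A i j = ≡.cong (uncurry A) (remQuot-combine {k = n} i j)

  heffter-entry-nonzero : ∀ {m n} (A : Matrix R m n) → IsHeffter R m n A → ∀ i j → A i j ≉ 0#
  heffter-entry-nonzero A (halfSet , _) i j Aij≈0 =
    halfSet-nonzero halfSet (combine i j) (trans (reflexive (entries-combine A i j)) Aij≈0)

  *-nonzeroˡ : ∀ {x y} → x · y ≉ 0# → x ≉ 0#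
  *-nonzeroˡ {x} {y} xy≉0 x≈0 = xy≉0 (trans (*-congʳ x≈0) (zeroˡ y))

proposition5 : {c ℓ : Level} (R : CommutativeRing c ℓ) (m n : ℕ) →
    IsFiniteField R (suc (2 * (m * n))) →
    (A : Matrix R m n) →
    IsHeffter R m n A →
    IsRankOne R A →
    (∀ (i : Fin m) → toℕ i ≡ 0 → DistinctPartialSums R (λ j → A i j)) →
    (∀ (j : Fin n) → toℕ j ≡ 0 → DistinctPartialSums R (λ i → A i j)) →
    IsGloballySimple R A
proposition5 R ℕ.zero  n      _ A _ _ _ _ = (λ ()) , (λ _ ())
proposition5 R (suc m) ℕ.zero _ A _ _ _ _ = (λ _ ()) , (λ ())
proposition5 R (suc m) (suc n) (isField , _) A heffter (u , v , _ , _ , A≈uv) firstRow firstColumn =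
  rows , columns
  where
  open CommutativeRing R using (_≈_; _≉_; 0#; trans; *-comm) renaming (_*_ to _·_)

  A≈vu : ∀ i j → A i j ≈ v j · u i
  A≈vu i j = trans (A≈uv i j) (*-comm (u i) (v j))

  u-nonzero : ∀ i → u i ≉ 0#
  u-nonzero i = *-nonzeroˡ R λ uv≈0 → heffter-entry-nonzero R A heffter i zero (trans (A≈uv i zero) uv≈0)

  v-nonzero : ∀ j → v j ≉ 0#
  v-nonzero j = *-nonzeroˡ R λ vu≈0 → heffter-entry-nonzero R A heffter zero j (trans (A≈vu zero j) vu≈0)

  rows : ∀ i → DistinctPartialSums R (λ j → A i j)
  rows i = distinctPartialSums-proportional R isField (u-nonzero i)
    (A≈uv zero) (A≈uv i) (firstRow zero ≡.refl)

  columns : ∀ j → DistinctPartialSums R (λ i → A i j)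
  columns j = distinctPartialSums-proportional R isField (v-nonzero j)
    (λ i → A≈vu i zero) (λ i → A≈vu i j) (firstColumn zero ≡.refl)
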